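{- Let $m\ge 3$, $X=\mathbb{F}_{2^m}\setminus\{0,1\}$, and let $u,v\in X$ be distinct with $u+v\ne 1$. Put $z=u+v$ and $S=\{u,v,u+1,v+1\}$, and for $k\ge 3$ let $\Omega_{z,k},\omega_{\alpha,k},\tau_{\alpha,k}$ be as in the context. Then: (i) $\omega_{\alpha,k}\subset\Omega_{z,k}$ and $\tau_{\beta,k}\subset\Omega_{z,k}$ for all $\alpha,\beta\in S$; (ii) $\omega_{u,3}=\omega_{v+1,3}$ and $\omega_{v,3}=\omega_{u+1,3}$; if $k\ge 4$, then $\omega_{\alpha,k}\cap\omega_{\beta,k}=\emptyset$ for distinct $\alpha,\beta\in S$; (iii) $\omega_{u,4}=\tau_{v+1,4}$ and $\omega_{v,4}=\tau_{u+1,4}$; if $k\ge 5$, then $\omega_{\alpha,k}\cap\tau_{\beta,k}=\emptyset$ for all $\alpha,\beta\in S$; (iv) $\tau_{u,5}=\tau_{v+1,5}$ and $\tau_{v,5}=\tau_{u+1,5}$; if $k\ge 6$, then $\tau_{\alpha,k}\cap\tau_{\beta,k}=\emptyset$ for distinct $\alpha,\beta\in S$.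
   Context: $\mathbb{F}_{2^m}$ is the finite field with $2^m$ elements, with zero $0$ and unity $1$; all sums are in $\mathbb{F}_{2^m}$. For each integer $k\ge 2$, $W_k=\{B\subset X : |B|=k,\ \sum_{i\in B} i=1,\ \text{and } \binom{B}{\ell}\cap W_\ell=\emptyset \text{ for all } 2\le \ell\le k-3\}$ (recursive definition; $\binom{B}{\ell}$ is the set of $\ell$-subsets of $B$). Define $\Omega_{z,k}=\{B\in W_k : z\in B\}$; for $\alpha\in S$, $\omega_{\alpha,k}=\{B\in\Omega_{z,k}: \alpha\in B\setminus\{z\}\}$ and $\tau_{\alpha,k}=\{B\in\Omega_{z,k}: \text{there exist } a,b\in B\setminus\{z\} \text{ with } a+b=\alpha\}$. -}

module Defs where

open import Data.Nat using (ℕ; zero; suc; _+_; _≤_)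
open import Data.Bool using (Bool; true; false; _xor_)
open import Data.Vec using (Vec; zipWith; replicate)
open import Data.List using (List; []; _∷_; length; foldr)
open import Data.List.Membership.Propositional using (_∈_)
open import Data.List.Relation.Unary.All using (All)
open import Data.List.Relation.Unary.Unique.Propositional using (Unique)
open import Data.List.Relation.Binary.Sublist.Propositional using (_⊆_)
open import Data.Product using (_×_; ∃-syntax)
open import Data.Sum using (_⊎_)
open import Data.Empty using (⊥)
open import Relation.Nullary using (¬_)
open import Relation.Binary.PropositionalEquality using (_≡_; _≢_)

-- The additive group of F_{2^m}: vectors of m bits under xor.
-- (Only addition, 0 and the distinguished element 1 are used in the statement.)
F : ℕ → Set
F m = Vec Bool m

𝟘 : ∀ {m} → F m
𝟘 = replicate _ false

infixl 6 _⊕_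
_⊕_ : ∀ {m} → F m → F m → F m
_⊕_ = zipWith _xor_

Σ⊕ : ∀ {m} → List (F m) → F m
Σ⊕ = foldr _⊕_ 𝟘

-- X = F \ {0, 1}, where `one` plays the role of the unity 1
InX : ∀ {m} → F m → F m → Set
InX one x = (x ≢ 𝟘) × (x ≢ one)

-- A k-subset B of X represented as a duplicate-free list with entries in X,
-- having length k and summing to 1.
Base : ∀ {m} → F m → ℕ → List (F m) → Set
Base one k B = Unique B × All (InX one) B × (length B ≡ k) × (Σ⊕ B ≡ one)

-- W with an explicit fuel parameter (recursive definition of W_k);
-- the fuel is always sufficient in the call W below (inner calls have ℓ ≤ k-3 < fuel).
-- ℓ-subsets of B are the sublists of B of length ℓ.
Wf : ∀ {m} → F m → ℕ → ℕ → List (F m) → Set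
Wf one zero    k B = ⊥
Wf one (suc n) k B =
  Base one k B ×
  (∀ (ℓ : ℕ) → 2 ≤ ℓ → ℓ + 3 ≤ k → ∀ (C : List _) → C ⊆ B → length C ≡ ℓ → ¬ Wf one n ℓ C)

W : ∀ {m} → F m → ℕ → List (F m) → Set
W one k B = Wf one (suc k) k B

Ω : ∀ {m} → F m → F m → ℕ → List (F m) → Set
Ω one z k B = W one k B × z ∈ B

ω : ∀ {m} → F m → F m → F m → ℕ → List (F m) → Set
ω one z α k B = Ω one z k B × α ∈ B × α ≢ z

τ : ∀ {m} → F m → F m → F m → ℕ → List (F m) → Set
τ one z α k B = Ω one z k B ×
  ∃[ a ] ∃[ b ] (a ∈ B × a ≢ z × b ∈ B × b ≢ z × (a ⊕ b ≡ α))

InS : ∀ {m} → F m → F m → F m → F m → Set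
InS one u v α = (α ≡ u) ⊎ (α ≡ v) ⊎ (α ≡ u ⊕ one) ⊎ (α ≡ v ⊕ one)

-- Everything rests on one consequence of the recursive definition of W_k
-- (sum-∉⟨1⟩): a nonempty collection E of fewer than k distinct members of
-- B ∈ W_k never sums to 𝟘 or 1.  Indeed E and its complement D in B have sums
-- 𝟘 and 1 in some order; the part summing to 1 is a short sublist summing to 1
-- (forbidden, since such a sublist would itself lie in W), unless the part
-- summing to 𝟘 has at most two members (impossible for distinct members of X).
-- Adding z ∈ B to E extends this to sums in Span z 1 = {𝟘, z, 1, z ⊕ 1}
-- (sum-∉Span).  Since S = u ⊕ Span z 1 is a coset, two members of S differ by an
-- element of Span z 1, so two lists of members of B ∖ {z} summing to α, β ∈ S
-- must cancel completely (separation, via their symmetric difference); this gives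
-- all disjointness claims.  The equalities for small k come from computing the one
-- or two members of B left over by the complement, which are 1 ⊕ z ⊕ α; the
-- map α ↦ 1 ⊕ z ⊕ α exchanges u ↔ v ⊕ 1 and v ↔ u ⊕ 1.

module Submission where

open import Defs
open import Data.Nat using (ℕ; zero; suc; _+_; _*_; _≤_; _<_; z≤n; s≤s; _≤?_)
open import Data.Nat.Properties using (+-suc; +-comm; +-identityʳ; +-cancelʳ-≡; +-cancelʳ-<; ≤-refl; ≤-trans; ≤-pred; m≤m+n; m<m+n; n≮n; n≤1+n; +-monoʳ-≤; m+n≤o⇒n≤o; ≰⇒>)
open import Data.Nat.Divisibility using (_∣_; divides; _∣?_)
open import Relation.Nullary.Decidable using (from-no)
open import Data.Bool.Properties using (xor-assoc; xor-comm; xor-identityˡ; xor-identityʳ; xor-same)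
import Data.Bool.Properties as Bool
open import Data.Vec using ([]; _∷_)
open import Data.Vec.Properties using (zipWith-assoc; zipWith-comm; zipWith-identityˡ; zipWith-identityʳ; ≡-dec)
open import Data.List using (List; []; _∷_; length)
open import Data.List.Membership.Propositional using (_∈_; _∉_)
open import Data.List.Relation.Unary.Any using (here; there; _─_; any?)
open import Data.List.Relation.Unary.All using (All; []; _∷_)
import Data.List.Relation.Unary.All as All
open import Data.List.Relation.Unary.All.Properties using (¬Any⇒All¬)
open import Data.List.Relation.Unary.Unique.Propositional using (Unique)
open import Data.List.Relation.Unary.AllPairs using ([]; _∷_)
open import Data.List.Relation.Binary.Sublist.Propositional using (_⊆_; []; _∷_; _∷ʳ_; ⊆-refl; ⊆-trans)
open import Data.List.Relation.Binary.Sublist.Propositional.Properties using (All-resp-⊆; Any-resp-⊆)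
open import Data.Product using (_×_; _,_; proj₁; proj₂; ∃-syntax)
open import Data.Sum using (_⊎_; inj₁; inj₂)
open import Data.Empty using (⊥-elim)
open import Relation.Nullary using (¬_; Dec; yes; no; contradiction)
open import Relation.Binary.PropositionalEquality using (_≡_; _≢_; refl; sym; trans; cong; cong₂; subst; subst₂; ≢-sym; module ≡-Reasoning)
open import Function using (_∘_)

private
  variable
    m : ℕ

⊕-assoc : (x y w : F m) → (x ⊕ y) ⊕ w ≡ x ⊕ (y ⊕ w)
⊕-assoc = zipWith-assoc xor-assoc

⊕-comm : (x y : F m) → x ⊕ y ≡ y ⊕ x
⊕-comm = zipWith-comm xor-comm

⊕-identityˡ : (x : F m) → 𝟘 ⊕ x ≡ x
⊕-identityˡ = zipWith-identityˡ xor-identityˡ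

⊕-identityʳ : (x : F m) → x ⊕ 𝟘 ≡ x
⊕-identityʳ = zipWith-identityʳ xor-identityʳ

⊕-self : (x : F m) → x ⊕ x ≡ 𝟘
⊕-self []      = refl
⊕-self (b ∷ x) = cong₂ _∷_ (xor-same b) (⊕-self x)

⊕-cancelˡ : (x y : F m) → x ⊕ (x ⊕ y) ≡ y
⊕-cancelˡ x y = begin
  x ⊕ (x ⊕ y)  ≡⟨ sym (⊕-assoc x x y) ⟩
  (x ⊕ x) ⊕ y  ≡⟨ cong (_⊕ y) (⊕-self x) ⟩
  𝟘 ⊕ y        ≡⟨ ⊕-identityˡ y ⟩
  y            ∎
  where open ≡-Reasoning

⊕-solveˡ : {x y w : F m} → x ⊕ y ≡ w → y ≡ x ⊕ w
⊕-solveˡ {x = x} {y} e = trans (sym (⊕-cancelˡ x y)) (cong (x ⊕_) e)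

⊕-solveʳ : {x y w : F m} → x ⊕ y ≡ w → x ≡ w ⊕ y
⊕-solveʳ {x = x} {y} e = trans (⊕-solveˡ (trans (⊕-comm y x) e)) (⊕-comm y _)

⊕≡𝟘⇒≡ : {x y : F m} → x ⊕ y ≡ 𝟘 → x ≡ y
⊕≡𝟘⇒≡ {y = y} e = trans (⊕-solveʳ e) (⊕-identityˡ y)

⊕≢𝟘⇒≢ : {x y q : F m} → x ⊕ y ≡ q → q ≢ 𝟘 → x ≢ y
⊕≢𝟘⇒≢ {x = x} x⊕y≡q q≢𝟘 refl = q≢𝟘 (trans (sym x⊕y≡q) (⊕-self x))

⊕-swapˡ : (x y w : F m) → x ⊕ (y ⊕ w) ≡ y ⊕ (x ⊕ w)
⊕-swapˡ x y w = begin
  x ⊕ (y ⊕ w)  ≡⟨ sym (⊕-assoc x y w) ⟩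
  (x ⊕ y) ⊕ w  ≡⟨ cong (_⊕ w) (⊕-comm x y) ⟩
  (y ⊕ x) ⊕ w  ≡⟨ ⊕-assoc y x w ⟩
  y ⊕ (x ⊕ w)  ∎
  where open ≡-Reasoning

⊕-medial : (a b c d : F m) → (a ⊕ b) ⊕ (c ⊕ d) ≡ (a ⊕ c) ⊕ (b ⊕ d)
⊕-medial a b c d = begin
  (a ⊕ b) ⊕ (c ⊕ d)  ≡⟨ ⊕-assoc a b (c ⊕ d) ⟩
  a ⊕ (b ⊕ (c ⊕ d))  ≡⟨ cong (a ⊕_) (⊕-swapˡ b c d) ⟩
  a ⊕ (c ⊕ (b ⊕ d))  ≡⟨ sym (⊕-assoc a c (b ⊕ d)) ⟩
  (a ⊕ c) ⊕ (b ⊕ d)  ∎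
  where open ≡-Reasoning

_≟F_ : (x y : F m) → Dec (x ≡ y)
_≟F_ = ≡-dec Bool._≟_

_∈F?_ : (x : F m) (xs : List (F m)) → Dec (x ∈ xs)
x ∈F? xs = any? (x ≟F_) xs

Σ⊕-singleton : (a : F m) → Σ⊕ (a ∷ []) ≡ a
Σ⊕-singleton = ⊕-identityʳ

Σ⊕-pair : (a b : F m) → Σ⊕ (a ∷ b ∷ []) ≡ a ⊕ b
Σ⊕-pair a b = cong (a ⊕_) (⊕-identityʳ b)

module _ {A : Set} where

  ─-⊆ : {x : A} {xs : List A} (p : x ∈ xs) → (xs ─ p) ⊆ xs
  ─-⊆ (here refl) = _ ∷ʳ ⊆-refl
  ─-⊆ (there p)   = refl ∷ ─-⊆ p

  ─-length : {x : A} {xs : List A} (p : x ∈ xs) → suc (length (xs ─ p)) ≡ length xs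
  ─-length (here refl) = refl
  ─-length (there p)   = cong suc (─-length p)

  ∈-─ : {x y : A} {xs : List A} (p : x ∈ xs) → y ∈ xs → y ≢ x → y ∈ (xs ─ p)
  ∈-─ (here refl) (here refl) y≢x = ⊥-elim (y≢x refl)
  ∈-─ (here refl) (there q)   _   = q
  ∈-─ (there p)   (here refl) _   = here refl
  ∈-─ (there p)   (there q)   y≢x = there (∈-─ p q y≢x)

  ∉-─ : {x y : A} {xs : List A} → Unique xs → (p : x ∈ xs) → y ∈ (xs ─ p) → y ≢ x
  ∉-─ (x≢xs ∷ _)  (here refl) q           refl = All.lookup x≢xs q refl
  ∉-─ (y≢xs ∷ _)  (there p)   (here refl) refl = All.lookup y≢xs p refl
  ∉-─ (_ ∷ uxs)   (there p)   (there q)        = ∉-─ uxs p q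

  Unique-⊆ : {xs ys : List A} → Unique ys → xs ⊆ ys → Unique xs
  Unique-⊆ []          []         = []
  Unique-⊆ (_ ∷ uys)   (_ ∷ʳ σ)   = Unique-⊆ uys σ
  Unique-⊆ (y≢ys ∷ uys) (refl ∷ σ) = All-resp-⊆ σ y≢ys ∷ Unique-⊆ uys σ

Σ⊕-─ : {x : F m} {xs : List (F m)} (p : x ∈ xs) → x ⊕ Σ⊕ (xs ─ p) ≡ Σ⊕ xs
Σ⊕-─ (here refl)              = refl
Σ⊕-─ {x = x} (there {y} p) = trans (⊕-swapˡ x y _) (cong (y ⊕_) (Σ⊕-─ p))

record Complement (B E : List (F m)) : Set where
  field
    rest        : List (F m)
    rest-⊆      : rest ⊆ B
    rest-∉      : All (_∉ E) rest
    rest-length : length rest + length E ≡ length B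
    rest-sum    : Σ⊕ rest ⊕ Σ⊕ E ≡ Σ⊕ B

complement : {B E : List (F m)} → Unique B → Unique E → All (_∈ B) E → Complement B E
complement {B = B} _ [] [] = record
  { rest = B ; rest-⊆ = ⊆-refl ; rest-∉ = All.tabulate (λ _ ())
  ; rest-length = +-identityʳ _ ; rest-sum = ⊕-identityʳ _ }
complement {B = B} {e ∷ E} uB (e≢E ∷ uE) (e∈B ∷ E⊆B) = record
  { rest        = rest
  ; rest-⊆      = ⊆-trans rest-⊆ (─-⊆ e∈B)
  ; rest-∉      = All.tabulate outside
  ; rest-length = trans (+-suc (length rest) (length E)) (trans (cong suc rest-length) (─-length e∈B))
  ; rest-sum    = begin
      Σ⊕ rest ⊕ (e ⊕ Σ⊕ E)  ≡⟨ ⊕-swapˡ (Σ⊕ rest) e (Σ⊕ E) ⟩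
      e ⊕ (Σ⊕ rest ⊕ Σ⊕ E)  ≡⟨ cong (e ⊕_) rest-sum ⟩
      e ⊕ Σ⊕ (B ─ e∈B)      ≡⟨ Σ⊕-─ e∈B ⟩
      Σ⊕ B                  ∎
  }
  where
  open ≡-Reasoning
  E⊆B─e : All (_∈ (B ─ e∈B)) E
  E⊆B─e = All.zipWith (λ (x∈B , e≢x) → ∈-─ e∈B x∈B (λ x≡e → e≢x (sym x≡e))) (E⊆B , e≢E)
  open Complement (complement (Unique-⊆ uB (─-⊆ e∈B)) uE E⊆B─e)
  outside : {x : F _} → x ∈ rest → x ∉ e ∷ E
  outside x∈rest (here x≡e)  = ∉-─ uB e∈B (Any-resp-⊆ rest-⊆ x∈rest) x≡e
  outside x∈rest (there x∈E) = All.lookup rest-∉ x∈rest x∈E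

-- The symmetric difference of X and Y (Y duplicate-free), computed by toggling the
-- members of X in and out of Y: a duplicate-free list with sum Σ⊕ X ⊕ Σ⊕ Y whose
-- length falls short of |X| + |Y| by an even number (two per cancelled pair), and
-- which inherits every property shared by the members of X and Y.
record SymDiff (P : F m → Set) (X Y : List (F m)) : Set where
  field
    list      : List (F m)
    unique    : Unique list
    all       : All P list
    sum       : Σ⊕ list ≡ Σ⊕ X ⊕ Σ⊕ Y
    cancelled : ∃[ r ] length list + r * 2 ≡ length X + length Y

symDiff : {P : F m → Set} (X : List (F m)) {Y : List (F m)} →
          Unique Y → All P X → All P Y → SymDiff P X Y
symDiff [] {Y} uY [] PY = record
  { list = Y ; unique = uY ; all = PY ; sum = sym (⊕-identityˡ (Σ⊕ Y))
  ; cancelled = 0 , +-identityʳ (length Y) }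
symDiff {P = P} (x ∷ X) {Y} uY (Px ∷ PX) PY = toggle (x ∈F? list)
  where
  open SymDiff (symDiff X uY PX PY)
  open ≡-Reasoning
  toggle : Dec (x ∈ list) → SymDiff P (x ∷ X) Y
  toggle (yes x∈E) = record
    { list = list ─ x∈E
    ; unique = Unique-⊆ unique (─-⊆ x∈E)
    ; all = All-resp-⊆ (─-⊆ x∈E) all
    ; sum = begin
        Σ⊕ (list ─ x∈E)        ≡⟨ ⊕-solveˡ (Σ⊕-─ x∈E) ⟩
        x ⊕ Σ⊕ list            ≡⟨ cong (x ⊕_) sum ⟩
        x ⊕ (Σ⊕ X ⊕ Σ⊕ Y)      ≡⟨ sym (⊕-assoc x (Σ⊕ X) (Σ⊕ Y)) ⟩
        (x ⊕ Σ⊕ X) ⊕ Σ⊕ Y      ∎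
    ; cancelled = suc r , (begin
        length (list ─ x∈E) + suc (suc (r * 2))  ≡⟨ +-suc _ (suc (r * 2)) ⟩
        suc (length (list ─ x∈E) + suc (r * 2))  ≡⟨ cong suc (+-suc _ (r * 2)) ⟩
        suc (suc (length (list ─ x∈E)) + r * 2)  ≡⟨ cong (λ n → suc (n + r * 2)) (─-length x∈E) ⟩
        suc (length list + r * 2)                ≡⟨ cong suc r-eq ⟩
        suc (length X + length Y)                ∎)
    }
    where
    r = proj₁ cancelled
    r-eq = proj₂ cancelled
  toggle (no x∉E) = record
    { list = x ∷ list
    ; unique = ¬Any⇒All¬ list x∉E ∷ unique
    ; all = Px ∷ all
    ; sum = trans (cong (x ⊕_) sum) (sym (⊕-assoc x (Σ⊕ X) (Σ⊕ Y)))
    ; cancelled = proj₁ cancelled , cong suc (proj₂ cancelled)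
    }

⟨_⟩ : F m → F m → Set
⟨ a ⟩ t = t ≡ 𝟘 ⊎ t ≡ a

Span : F m → F m → F m → Set
Span a b t = ∃[ s ] ∃[ e ] ⟨ a ⟩ s × ⟨ b ⟩ e × t ≡ s ⊕ e

⟨⟩-closed : {a s s′ : F m} → ⟨ a ⟩ s → ⟨ a ⟩ s′ → ⟨ a ⟩ (s ⊕ s′)
⟨⟩-closed {s′ = s′} (inj₁ refl) s′∈⟨a⟩ = subst ⟨ _ ⟩ (sym (⊕-identityˡ s′)) s′∈⟨a⟩
⟨⟩-closed {a = a} (inj₂ refl) (inj₁ refl) = inj₂ (⊕-identityʳ a)
⟨⟩-closed {a = a} (inj₂ refl) (inj₂ refl) = inj₁ (⊕-self a)

Span-closed : {a b t t′ : F m} → Span a b t → Span a b t′ → Span a b (t ⊕ t′)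
Span-closed (s , e , s∈ , e∈ , t≡) (s′ , e′ , s′∈ , e′∈ , t′≡) =
  s ⊕ s′ , e ⊕ e′ , ⟨⟩-closed s∈ s′∈ , ⟨⟩-closed e∈ e′∈ ,
  trans (cong₂ _⊕_ t≡ t′≡) (⊕-medial s e s′ e′)

Off : F m → List (F m) → F m → Set
Off z B x = x ∈ B × x ≢ z

1≤-complement : {a b k : ℕ} → a + b ≡ k → b < k → 1 ≤ a
1≤-complement {zero}  refl b<b = contradiction b<b (n≮n _)
1≤-complement {suc a} _    _   = s≤s z≤n

module _ {m : ℕ} (one : F m) where

  base-unique : {k : ℕ} {B : List (F m)} → Base one k B → Unique B
  base-unique = proj₁

  base-inX : {k : ℕ} {B : List (F m)} → Base one k B → All (InX one) B
  base-inX = proj₁ ∘ proj₂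

  base-length : {k : ℕ} {B : List (F m)} → Base one k B → length B ≡ k
  base-length = proj₁ ∘ proj₂ ∘ proj₂

  base-sum : {k : ℕ} {B : List (F m)} → Base one k B → Σ⊕ B ≡ one
  base-sum = proj₂ ∘ proj₂ ∘ proj₂

  base-of : (n : ℕ) {k : ℕ} {B : List (F m)} → Wf one n k B → Base one k B
  base-of zero    ()
  base-of (suc n) = proj₁

  -- The heart of the recursive definition: a sublist C of B ∈ W_k with
  -- 2 ≤ |C| ≤ k - 3 never sums to 1.  Otherwise C, all of whose own short
  -- sublists are excluded by the same argument (induction on the bound n ≥ |C|),
  -- would itself lie in W_{|C|}, which B ∈ W_k forbids.
  no-unit-sublist≥2 : {k : ℕ} {B : List (F m)} → W one k B → (n : ℕ) (C : List (F m)) →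
                      length C ≤ n → C ⊆ B → 2 ≤ length C → length C + 3 ≤ k → Σ⊕ C ≢ one
  no-unit-sublist≥2 {zero} _ _ C _ _ _ |C|+3≤0 _ = contradiction (m+n≤o⇒n≤o (length C) |C|+3≤0) λ ()
  no-unit-sublist≥2 _ zero _ |C|≤0 _ 2≤|C| _ _ = contradiction (≤-trans 2≤|C| |C|≤0) λ ()
  no-unit-sublist≥2 {suc k} w (suc n) C |C|≤1+n C⊆B 2≤|C| |C|+3≤k ΣC≡1 =
    proj₂ w (length C) 2≤|C| |C|+3≤k C C⊆B refl (C-base , C-minimal)
    where
    C-base : Base one (length C) C
    C-base = Unique-⊆ (base-unique (proj₁ w)) C⊆B , All-resp-⊆ C⊆B (base-inX (proj₁ w)) , refl , ΣC≡1
    C-minimal : ∀ ℓ → 2 ≤ ℓ → ℓ + 3 ≤ length C → ∀ C′ → C′ ⊆ C → length C′ ≡ ℓ → ¬ Wf one k ℓ C′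
    C-minimal ℓ 2≤ℓ ℓ+3≤|C| C′ C′⊆C refl C′∈W =
      no-unit-sublist≥2 w n C′ ℓ≤n (⊆-trans C′⊆C C⊆B) 2≤ℓ ℓ+3≤k (base-sum (base-of k C′∈W))
      where
      ℓ≤n : ℓ ≤ n
      ℓ≤n = ≤-pred (≤-trans (≤-trans (m<m+n ℓ (s≤s z≤n)) ℓ+3≤|C|) |C|≤1+n)
      ℓ+3≤k : ℓ + 3 ≤ suc k
      ℓ+3≤k = ≤-trans ℓ+3≤|C| (≤-trans (m≤m+n (length C) 3) |C|+3≤k)

  -- No nonempty sublist of B ∈ W_k with at most k - 3 members sums to 1
  -- (a single member differs from 1 because B ⊆ X).
  no-unit-sublist : {k : ℕ} {B C : List (F m)} → W one k B → C ⊆ B →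
                    1 ≤ length C → length C + 3 ≤ k → Σ⊕ C ≢ one
  no-unit-sublist {C = x ∷ []} w C⊆B _ _ Σ≡1 =
    proj₂ (All.lookup (base-inX (proj₁ w)) (Any-resp-⊆ C⊆B (here refl))) (trans (sym (⊕-identityʳ x)) Σ≡1)
  no-unit-sublist {C = C@(_ ∷ _ ∷ _)} w C⊆B _ short = no-unit-sublist≥2 w (length C) C ≤-refl C⊆B (s≤s (s≤s z≤n)) short

  no-small-zero : {L : List (F m)} → Unique L → All (InX one) L → 1 ≤ length L → length L < 3 → Σ⊕ L ≢ 𝟘
  no-small-zero {x ∷ []} _ (x∈X ∷ []) _ _ Σ≡𝟘 = proj₁ x∈X (trans (sym (⊕-identityʳ x)) Σ≡𝟘)
  no-small-zero {x ∷ y ∷ []} ((x≢y ∷ []) ∷ _) _ _ _ Σ≡𝟘 = x≢y (⊕≡𝟘⇒≡ (trans (sym (Σ⊕-pair x y)) Σ≡𝟘))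
  no-small-zero {_ ∷ _ ∷ _ ∷ _} _ _ _ (s≤s (s≤s (s≤s ())))

  -- B ∈ W_k never splits into nonempty sublists C, D with ΣC ≡ 𝟘 and ΣD ≡ 1:
  -- either D is short (|D| ≤ k - 3), or C has at most two members.
  no-zero-unit-split : {k : ℕ} {B C D : List (F m)} → W one k B → C ⊆ B → D ⊆ B →
                       1 ≤ length C → 1 ≤ length D → length C + length D ≡ k →
                       Σ⊕ C ≡ 𝟘 → Σ⊕ D ≢ one
  no-zero-unit-split {k} {C = C} {D} w C⊆B D⊆B 1≤|C| 1≤|D| |C|+|D|≡k ΣC≡𝟘 with length D + 3 ≤? k
  ... | yes short = no-unit-sublist w D⊆B 1≤|D| short
  ... | no long   = λ _ → no-small-zero (Unique-⊆ (base-unique (proj₁ w)) C⊆B)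
                            (All-resp-⊆ C⊆B (base-inX (proj₁ w))) 1≤|C| |C|<3 ΣC≡𝟘
    where
    |C|<3 : length C < 3
    |C|<3 = +-cancelʳ-< (length D) (length C) 3
              (subst₂ _<_ (sym |C|+|D|≡k) (+-comm (length D) 3) (≰⇒> long))

  -- Key lemma: a nonempty collection E of fewer than k distinct members of
  -- B ∈ W_k never sums to 𝟘 or 1.  Its complement D in B sums to 1 ⊕ ΣE, so one of
  -- E, D sums to 𝟘 and the other to 1; replacing E by the complement C of D (a
  -- sublist of B with the same length and sum) contradicts no-zero-unit-split.
  sum-∉⟨1⟩ : {k : ℕ} {B E : List (F m)} → W one k B → Unique E → All (_∈ B) E →
             1 ≤ length E → length E < k → ¬ ⟨ one ⟩ (Σ⊕ E)
  sum-∉⟨1⟩ {k} {B} {E} w uE E⊆B 1≤|E| |E|<k = contradict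
    where
    bB = proj₁ w
    module D = Complement (complement (base-unique bB) uE E⊆B)
    module C = Complement (complement (base-unique bB) (Unique-⊆ (base-unique bB) D.rest-⊆)
                                      (All.tabulate (Any-resp-⊆ D.rest-⊆)))
    |D|+|E|≡k : length D.rest + length E ≡ k
    |D|+|E|≡k = trans D.rest-length (base-length bB)
    |C|+|D|≡k : length C.rest + length D.rest ≡ k
    |C|+|D|≡k = trans C.rest-length (base-length bB)
    1≤|D| : 1 ≤ length D.rest
    1≤|D| = 1≤-complement |D|+|E|≡k |E|<k
    1≤|C| : 1 ≤ length C.rest
    1≤|C| = subst (1 ≤_) (sym |C|≡|E|) 1≤|E|
      where
      |C|≡|E| : length C.rest ≡ length E
      |C|≡|E| = +-cancelʳ-≡ (length D.rest) _ _ (trans |C|+|D|≡k (trans (sym |D|+|E|≡k) (+-comm _ (length E))))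
    ΣD≡1⊕ΣE : Σ⊕ D.rest ≡ one ⊕ Σ⊕ E
    ΣD≡1⊕ΣE = ⊕-solveʳ (trans D.rest-sum (base-sum bB))
    ΣC≡1⊕ΣD : Σ⊕ C.rest ≡ one ⊕ Σ⊕ D.rest
    ΣC≡1⊕ΣD = ⊕-solveʳ (trans C.rest-sum (base-sum bB))
    contradict : ¬ ⟨ one ⟩ (Σ⊕ E)
    contradict (inj₁ ΣE≡𝟘) =
      no-zero-unit-split w C.rest-⊆ D.rest-⊆ 1≤|C| 1≤|D| |C|+|D|≡k
        (trans ΣC≡1⊕ΣD (trans (cong (one ⊕_) ΣD≡1) (⊕-self one))) ΣD≡1
      where
      ΣD≡1 : Σ⊕ D.rest ≡ one
      ΣD≡1 = trans ΣD≡1⊕ΣE (trans (cong (one ⊕_) ΣE≡𝟘) (⊕-identityʳ one))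
    contradict (inj₂ ΣE≡1) =
      no-zero-unit-split w D.rest-⊆ C.rest-⊆ 1≤|D| 1≤|C| (trans (+-comm _ (length C.rest)) |C|+|D|≡k)
        ΣD≡𝟘 (trans ΣC≡1⊕ΣD (trans (cong (one ⊕_) ΣD≡𝟘) (⊕-identityʳ one)))
      where
      ΣD≡𝟘 : Σ⊕ D.rest ≡ 𝟘
      ΣD≡𝟘 = trans ΣD≡1⊕ΣE (trans (cong (one ⊕_) ΣE≡1) (⊕-self one))

  -- For z ∈ B ∈ W_k, no nonempty collection E of at most k - 2 distinct members of
  -- B other than z sums into Span z 1: a sum in ⟨ 1 ⟩ is excluded by sum-∉⟨1⟩ for
  -- E, a sum in z ⊕ ⟨ 1 ⟩ by sum-∉⟨1⟩ for z ∷ E.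
  sum-∉Span : {k : ℕ} {z : F m} {B E : List (F m)} → W one k B → z ∈ B → Unique E →
              All (Off z B) E → 1 ≤ length E → 2 + length E ≤ k → ¬ Span z one (Σ⊕ E)
  sum-∉Span w _ uE E-off 1≤|E| bound (_ , e , inj₁ refl , e∈⟨1⟩ , ΣE≡𝟘⊕e) =
    sum-∉⟨1⟩ w uE (All.map proj₁ E-off) 1≤|E| (≤-trans (n≤1+n _) bound)
      (subst ⟨ one ⟩ (sym (trans ΣE≡𝟘⊕e (⊕-identityˡ e))) e∈⟨1⟩)
  sum-∉Span {z = z} {E = E} w z∈B uE E-off _ bound (_ , e , inj₂ refl , e∈⟨1⟩ , ΣE≡z⊕e) =
    sum-∉⟨1⟩ w (z∉E ∷ uE) (z∈B ∷ All.map proj₁ E-off) (s≤s z≤n) bound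
      (subst ⟨ one ⟩ (sym (trans (cong (z ⊕_) ΣE≡z⊕e) (⊕-cancelˡ z e))) e∈⟨1⟩)
    where
    z∉E : All (z ≢_) E
    z∉E = All.map (λ (_ , x≢z) → ≢-sym x≢z) E-off

  -- Separation: if two lists X, Y of members of B ∖ {z} (Y duplicate-free) have
  -- total sum in Span z 1 and |X| + |Y| ≤ k - 2, then they cancel completely:
  -- their symmetric difference is empty, so ΣX ≡ ΣY and |X| + |Y| is even.
  separation : {k : ℕ} {z : F m} {B : List (F m)} → W one k B → z ∈ B →
               (X : List (F m)) {Y : List (F m)} → Unique Y → All (Off z B) X → All (Off z B) Y →
               2 + (length X + length Y) ≤ k → Span z one (Σ⊕ X ⊕ Σ⊕ Y) →
               (Σ⊕ X ≡ Σ⊕ Y) × 2 ∣ length X + length Y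
  separation {k} {z} w z∈B X {Y} uY X-off Y-off bound span = conclude (symDiff X uY X-off Y-off)
    where
    conclude : SymDiff (Off z _) X Y → (Σ⊕ X ≡ Σ⊕ Y) × 2 ∣ length X + length Y
    conclude record { list = [] ; sum = 𝟘≡ΣX⊕ΣY ; cancelled = r , r*2≡ } =
      ⊕≡𝟘⇒≡ (sym 𝟘≡ΣX⊕ΣY) , divides r (sym r*2≡)
    conclude record { list = E@(_ ∷ _) ; unique = uE ; all = E-off ; sum = ΣE≡ ; cancelled = r , eq } =
      ⊥-elim (sum-∉Span w z∈B uE E-off (s≤s z≤n) (≤-trans (+-monoʳ-≤ 2 |E|≤) bound)
                        (subst (Span z one) (sym ΣE≡) span))
      where
      |E|≤ : length E ≤ length X + length Y
      |E|≤ = subst (length E ≤_) eq (m≤m+n (length E) (r * 2))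

  last-member : {k : ℕ} {B E : List (F m)} → Base one k B → Unique E → All (_∈ B) E →
                suc (length E) ≡ k → (one ⊕ Σ⊕ E) ∈ B × (one ⊕ Σ⊕ E) ∉ E
  last-member {B = B} {E} bB uE E⊆B |E|+1≡k = from-rest rest rest-⊆ rest-∉ |rest|≡1 Σrest≡
    where
    open Complement (complement (base-unique bB) uE E⊆B)
    |rest|≡1 : length rest ≡ 1
    |rest|≡1 = +-cancelʳ-≡ (length E) _ 1 (trans rest-length (trans (base-length bB) (sym |E|+1≡k)))
    Σrest≡ : Σ⊕ rest ≡ one ⊕ Σ⊕ E
    Σrest≡ = ⊕-solveʳ (trans rest-sum (base-sum bB))
    from-rest : (D : List (F m)) → D ⊆ B → All (_∉ E) D → length D ≡ 1 → Σ⊕ D ≡ one ⊕ Σ⊕ E →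
                (one ⊕ Σ⊕ E) ∈ B × (one ⊕ Σ⊕ E) ∉ E
    from-rest (c ∷ []) c⊆B (c∉E ∷ []) _ ΣD≡ =
      subst (λ x → x ∈ B × x ∉ E) (trans (sym (Σ⊕-singleton c)) ΣD≡) (Any-resp-⊆ c⊆B (here refl) , c∉E)

  last-pair : {k : ℕ} {B E : List (F m)} → Base one k B → Unique E → All (_∈ B) E →
              suc (suc (length E)) ≡ k →
              ∃[ c ] ∃[ d ] (c ∈ B × c ∉ E) × (d ∈ B × d ∉ E) × c ⊕ d ≡ one ⊕ Σ⊕ E
  last-pair {B = B} {E} bB uE E⊆B |E|+2≡k = from-rest rest rest-⊆ rest-∉ |rest|≡2 Σrest≡
    where
    open Complement (complement (base-unique bB) uE E⊆B)
    |rest|≡2 : length rest ≡ 2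
    |rest|≡2 = +-cancelʳ-≡ (length E) _ 2 (trans rest-length (trans (base-length bB) (sym |E|+2≡k)))
    Σrest≡ : Σ⊕ rest ≡ one ⊕ Σ⊕ E
    Σrest≡ = ⊕-solveʳ (trans rest-sum (base-sum bB))
    from-rest : (D : List (F m)) → D ⊆ B → All (_∉ E) D → length D ≡ 2 → Σ⊕ D ≡ one ⊕ Σ⊕ E →
                ∃[ c ] ∃[ d ] (c ∈ B × c ∉ E) × (d ∈ B × d ∉ E) × c ⊕ d ≡ one ⊕ Σ⊕ E
    from-rest (c ∷ d ∷ []) D⊆B (c∉E ∷ d∉E ∷ []) _ ΣD≡ =
      c , d , (Any-resp-⊆ D⊆B (here refl) , c∉E) , (Any-resp-⊆ D⊆B (there (here refl)) , d∉E) ,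
      trans (sym (Σ⊕-pair c d)) ΣD≡

  -- Removing from
  -- B ∈ Ω_{z,k} the known members leaves one member, or two members with sum,
  -- equal to 1 ⊕ z ⊕ (the sum of what was removed).
  module _ {z : F m} {B : List (F m)} where

    private
      pair-unique : {p : F m} → p ≢ z → Unique (z ∷ p ∷ [])
      pair-unique p≢z = (≢-sym p≢z ∷ []) ∷ [] ∷ []

      triple-unique : {a b q : F m} → a ≢ z → b ≢ z → a ⊕ b ≡ q → q ≢ 𝟘 → Unique (z ∷ a ∷ b ∷ [])
      triple-unique a≢z b≢z a⊕b≡q q≢𝟘 = (≢-sym a≢z ∷ ≢-sym b≢z ∷ []) ∷ (⊕≢𝟘⇒≢ a⊕b≡q q≢𝟘 ∷ []) ∷ [] ∷ []

      off-z : {c : F m} {E : List (F m)} → c ∈ B × c ∉ z ∷ E → c ∈ B × c ≢ z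
      off-z (c∈B , c∉E) = c∈B , c∉E ∘ here

    ω₃-transfer : {p : F m} → ω one z p 3 B → ω one z (one ⊕ (z ⊕ p)) 3 B
    ω₃-transfer {p} ((w , z∈B) , p∈B , p≢z) =
      (w , z∈B) , off-z (subst (λ x → x ∈ B × x ∉ z ∷ p ∷ []) (cong (one ⊕_) (Σ⊕-pair z p))
                          (last-member (proj₁ w) (pair-unique p≢z) (z∈B ∷ p∈B ∷ []) refl))

    ω₄→τ₄ : {p : F m} → ω one z p 4 B → τ one z (one ⊕ (z ⊕ p)) 4 B
    ω₄→τ₄ {p} ((w , z∈B) , p∈B , p≢z)
      with last-pair (proj₁ w) (pair-unique p≢z) (z∈B ∷ p∈B ∷ []) refl
    ... | c , d , (c∈B , c∉E) , (d∈B , d∉E) , c⊕d≡ =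
      (w , z∈B) , c , d , c∈B , c∉E ∘ here , d∈B , d∉E ∘ here , trans c⊕d≡ (cong (one ⊕_) (Σ⊕-pair z p))

    τ₄→ω₄ : {q : F m} → q ≢ 𝟘 → τ one z q 4 B → ω one z (one ⊕ (z ⊕ q)) 4 B
    τ₄→ω₄ q≢𝟘 ((w , z∈B) , a , b , a∈B , a≢z , b∈B , b≢z , a⊕b≡q) =
      (w , z∈B) , off-z (subst (λ x → x ∈ B × x ∉ z ∷ a ∷ b ∷ []) (cong (one ⊕_) Σ≡z⊕q)
                          (last-member (proj₁ w) (triple-unique a≢z b≢z a⊕b≡q q≢𝟘) (z∈B ∷ a∈B ∷ b∈B ∷ []) refl))
      where
      Σ≡z⊕q : Σ⊕ (z ∷ a ∷ b ∷ []) ≡ z ⊕ _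
      Σ≡z⊕q = cong (z ⊕_) (trans (Σ⊕-pair a b) a⊕b≡q)

    τ₅→τ₅ : {p : F m} → p ≢ 𝟘 → τ one z p 5 B → τ one z (one ⊕ (z ⊕ p)) 5 B
    τ₅→τ₅ p≢𝟘 ((w , z∈B) , a , b , a∈B , a≢z , b∈B , b≢z , a⊕b≡p)
      with last-pair (proj₁ w) (triple-unique a≢z b≢z a⊕b≡p p≢𝟘) (z∈B ∷ a∈B ∷ b∈B ∷ []) refl
    ... | c , d , (c∈B , c∉E) , (d∈B , d∉E) , c⊕d≡ =
      (w , z∈B) , c , d , c∈B , c∉E ∘ here , d∈B , d∉E ∘ here ,
      trans c⊕d≡ (cong (λ t → one ⊕ (z ⊕ t)) (trans (Σ⊕-pair a b) a⊕b≡p))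

module Configuration {m : ℕ} {one u v : F m} (u∈X : InX one u) (v∈X : InX one v) where

  z : F m
  z = u ⊕ v

  S-offset : {α : F m} → InS one u v α → Span z one (u ⊕ α)
  S-offset (inj₁ refl)               = 𝟘 , 𝟘 , inj₁ refl , inj₁ refl , trans (⊕-self u) (sym (⊕-identityˡ 𝟘))
  S-offset (inj₂ (inj₁ refl))        = z , 𝟘 , inj₂ refl , inj₁ refl , sym (⊕-identityʳ z)
  S-offset (inj₂ (inj₂ (inj₁ refl))) = 𝟘 , one , inj₁ refl , inj₂ refl , trans (⊕-cancelˡ u one) (sym (⊕-identityˡ one))
  S-offset (inj₂ (inj₂ (inj₂ refl))) = z , one , inj₂ refl , inj₂ refl , sym (⊕-assoc u v one)

  S-sum : {α β : F m} → InS one u v α → InS one u v β → Span z one (α ⊕ β)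
  S-sum {α} {β} α∈S β∈S = subst (Span z one) offsets-cancel (Span-closed (S-offset α∈S) (S-offset β∈S))
    where
    offsets-cancel : (u ⊕ α) ⊕ (u ⊕ β) ≡ α ⊕ β
    offsets-cancel = trans (⊕-medial u α u β) (trans (cong (_⊕ (α ⊕ β)) (⊕-self u)) (⊕-identityˡ (α ⊕ β)))

  S-nonzero : {α : F m} → InS one u v α → α ≢ 𝟘
  S-nonzero (inj₁ refl)               = proj₁ u∈X
  S-nonzero (inj₂ (inj₁ refl))        = proj₁ v∈X
  S-nonzero (inj₂ (inj₂ (inj₁ refl))) = proj₂ u∈X ∘ ⊕≡𝟘⇒≡
  S-nonzero (inj₂ (inj₂ (inj₂ refl))) = proj₂ v∈X ∘ ⊕≡𝟘⇒≡

  partner : F m → F m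
  partner x = one ⊕ (z ⊕ x)

  partner-involutive : (x : F m) → partner (partner x) ≡ x
  partner-involutive x = begin
    one ⊕ (z ⊕ (one ⊕ (z ⊕ x)))  ≡⟨ cong (one ⊕_) (⊕-swapˡ z one (z ⊕ x)) ⟩
    one ⊕ (one ⊕ (z ⊕ (z ⊕ x)))  ≡⟨ ⊕-cancelˡ one (z ⊕ (z ⊕ x)) ⟩
    z ⊕ (z ⊕ x)                  ≡⟨ ⊕-cancelˡ z x ⟩
    x                            ∎
    where open ≡-Reasoning

  partner-u : partner u ≡ v ⊕ one
  partner-u = trans (cong (one ⊕_) (trans (⊕-comm z u) (⊕-cancelˡ u v))) (⊕-comm one v)

  partner-v : partner v ≡ u ⊕ one
  partner-v = trans (cong (one ⊕_) (sym (⊕-solveʳ refl))) (⊕-comm one u)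

  partner-equalities : (R R′ : F m → Set) →
    (∀ {p} → p ≢ 𝟘 → R p → R′ (partner p)) → (∀ {q} → q ≢ 𝟘 → R′ q → R (partner q)) →
    ((R u → R′ (v ⊕ one)) × (R′ (v ⊕ one) → R u)) × ((R v → R′ (u ⊕ one)) × (R′ (u ⊕ one) → R v))
  partner-equalities R R′ to from =
    exchange (inj₁ refl) partner-u (inj₂ (inj₂ (inj₂ refl))) ,
    exchange (inj₂ (inj₁ refl)) partner-v (inj₂ (inj₂ (inj₁ refl)))
    where
    exchange : {x y : F m} → InS one u v x → partner x ≡ y → InS one u v y → (R x → R′ y) × (R′ y → R x)
    exchange {x} x∈S px≡y y∈S =
      (λ r → subst R′ px≡y (to (S-nonzero x∈S) r)) ,
      (λ r′ → subst R (trans (cong partner (sym px≡y)) (partner-involutive x)) (from (S-nonzero y∈S) r′))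

  S-separation : {k : ℕ} {α β : F m} {B : List (F m)} → W one k B → z ∈ B →
                 InS one u v α → InS one u v β →
                 (X : List (F m)) {Y : List (F m)} → Unique Y → All (Off z B) X → All (Off z B) Y →
                 2 + (length X + length Y) ≤ k → Σ⊕ X ≡ α → Σ⊕ Y ≡ β →
                 (α ≡ β) × 2 ∣ length X + length Y
  S-separation w z∈B α∈S β∈S X uY X-off Y-off bound ΣX≡α ΣY≡β =
    trans (sym ΣX≡α) (trans (proj₁ cancel) ΣY≡β) , proj₂ cancel
    where
    cancel = separation one w z∈B X uY X-off Y-off bound
               (subst (Span z one) (sym (cong₂ _⊕_ ΣX≡α ΣY≡β)) (S-sum α∈S β∈S))

  -- the disjointness claims: two one-element (resp. two-element) lists summing to
  -- distinct α, β ∈ S, or lists of total length 3, cannot cancel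
  ω-ω-disjoint : ∀ (k : ℕ) → 4 ≤ k → ∀ α β → InS one u v α → InS one u v β → α ≢ β →
                 ∀ (B : List (F m)) → ¬ (ω one z α k B × ω one z β k B)
  ω-ω-disjoint k 4≤k α β α∈S β∈S α≢β B (((w , z∈B) , α-off) , (_ , β-off)) =
    α≢β (proj₁ (S-separation w z∈B α∈S β∈S (α ∷ []) ([] ∷ []) (α-off ∷ []) (β-off ∷ []) 4≤k
                              (Σ⊕-singleton α) (Σ⊕-singleton β)))

  ω-τ-disjoint : ∀ (k : ℕ) → 5 ≤ k → ∀ α β → InS one u v α → InS one u v β →
                 ∀ (B : List (F m)) → ¬ (ω one z α k B × τ one z β k B)
  ω-τ-disjoint k 5≤k α β α∈S β∈S B (((w , z∈B) , α-off) , (_ , a , b , a∈B , a≢z , b∈B , b≢z , a⊕b≡β)) =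
    from-no (2 ∣? 3) (proj₂ (S-separation w z∈B α∈S β∈S (α ∷ []) ((⊕≢𝟘⇒≢ a⊕b≡β (S-nonzero β∈S) ∷ []) ∷ [] ∷ [])
                                          (α-off ∷ []) ((a∈B , a≢z) ∷ (b∈B , b≢z) ∷ []) 5≤k
                                          (Σ⊕-singleton α) (trans (Σ⊕-pair a b) a⊕b≡β)))

  τ-τ-disjoint : ∀ (k : ℕ) → 6 ≤ k → ∀ α β → InS one u v α → InS one u v β → α ≢ β →
                 ∀ (B : List (F m)) → ¬ (τ one z α k B × τ one z β k B)
  τ-τ-disjoint k 6≤k α β α∈S β∈S α≢β B
    (((w , z∈B) , a , b , a∈B , a≢z , b∈B , b≢z , a⊕b≡α) , (_ , c , d , c∈B , c≢z , d∈B , d≢z , c⊕d≡β)) =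
    α≢β (proj₁ (S-separation w z∈B α∈S β∈S (a ∷ b ∷ []) ((⊕≢𝟘⇒≢ c⊕d≡β (S-nonzero β∈S) ∷ []) ∷ [] ∷ [])
                              ((a∈B , a≢z) ∷ (b∈B , b≢z) ∷ []) ((c∈B , c≢z) ∷ (d∈B , d≢z) ∷ []) 6≤k
                              (trans (Σ⊕-pair a b) a⊕b≡α) (trans (Σ⊕-pair c d) c⊕d≡β)))

lemma3p11 : (m : ℕ) → 3 ≤ m → (one : F m) → one ≢ 𝟘 →
  (u v : F m) → InX one u → InX one v → u ≢ v → u ⊕ v ≢ one →
  -- (i)
  (∀ (k : ℕ) → 3 ≤ k → ∀ α β → InS one u v α → InS one u v β → ∀ (B : List (F m)) →
    (ω one (u ⊕ v) α k B → Ω one (u ⊕ v) k B) × (τ one (u ⊕ v) β k B → Ω one (u ⊕ v) k B))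
  ×
  -- (ii)
  ((∀ (B : List (F m)) →
    ((ω one (u ⊕ v) u 3 B → ω one (u ⊕ v) (v ⊕ one) 3 B) × (ω one (u ⊕ v) (v ⊕ one) 3 B → ω one (u ⊕ v) u 3 B)) ×
    ((ω one (u ⊕ v) v 3 B → ω one (u ⊕ v) (u ⊕ one) 3 B) × (ω one (u ⊕ v) (u ⊕ one) 3 B → ω one (u ⊕ v) v 3 B)))
   ×
   (∀ (k : ℕ) → 4 ≤ k → ∀ α β → InS one u v α → InS one u v β → α ≢ β → ∀ (B : List (F m)) →
     ¬ (ω one (u ⊕ v) α k B × ω one (u ⊕ v) β k B)))
  ×
  -- (iii)
  ((∀ (B : List (F m)) →
    ((ω one (u ⊕ v) u 4 B → τ one (u ⊕ v) (v ⊕ one) 4 B) × (τ one (u ⊕ v) (v ⊕ one) 4 B → ω one (u ⊕ v) u 4 B)) ×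
    ((ω one (u ⊕ v) v 4 B → τ one (u ⊕ v) (u ⊕ one) 4 B) × (τ one (u ⊕ v) (u ⊕ one) 4 B → ω one (u ⊕ v) v 4 B)))
   ×
   (∀ (k : ℕ) → 5 ≤ k → ∀ α β → InS one u v α → InS one u v β → ∀ (B : List (F m)) →
     ¬ (ω one (u ⊕ v) α k B × τ one (u ⊕ v) β k B)))
  ×
  -- (iv)
  ((∀ (B : List (F m)) →
    ((τ one (u ⊕ v) u 5 B → τ one (u ⊕ v) (v ⊕ one) 5 B) × (τ one (u ⊕ v) (v ⊕ one) 5 B → τ one (u ⊕ v) u 5 B)) ×
    ((τ one (u ⊕ v) v 5 B → τ one (u ⊕ v) (u ⊕ one) 5 B) × (τ one (u ⊕ v) (u ⊕ one) 5 B → τ one (u ⊕ v) v 5 B)))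
   ×
   (∀ (k : ℕ) → 6 ≤ k → ∀ α β → InS one u v α → InS one u v β → α ≢ β → ∀ (B : List (F m)) →
     ¬ (τ one (u ⊕ v) α k B × τ one (u ⊕ v) β k B)))
lemma3p11 _ _ one _ u v u∈X v∈X _ _ =
  (λ _ _ _ _ _ _ _ → proj₁ , proj₁) ,
  ((λ B → partner-equalities (λ α → ω one z α 3 B) (λ α → ω one z α 3 B)
            (λ _ → ω₃-transfer one) (λ _ → ω₃-transfer one)) ,
   ω-ω-disjoint) ,
  ((λ B → partner-equalities (λ α → ω one z α 4 B) (λ α → τ one z α 4 B)
            (λ _ → ω₄→τ₄ one) (τ₄→ω₄ one)) ,
   ω-τ-disjoint) ,
  ((λ B → partner-equalities (λ α → τ one z α 5 B) (λ α → τ one z α 5 B)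
            (τ₅→τ₅ one) (τ₅→τ₅ one)) ,
   τ-τ-disjoint)
  where open Configuration u∈X v∈X
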